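{- Let $G$ be a graph, $\eta \ge 1$, and $X \subseteq V(G)$ with $\mathrm{tw}(G - X) \le \eta$. Let $(C,S)$ be a simple $\eta$-separation in $G$ that is $\vartriangleleft$-maximal, and let $v \in C$. If $X \cap (C \cup S) = \emptyset$, then $S$ is an important $(v,X)$-separator.
   Context: Graphs are finite, simple, undirected; $N_G(C)$ is the set of vertices outside $C$ with a neighbor in $C$; $\mathrm{tw}$ denotes treewidth. An $\eta$-separation in $G$ is a pair $(C,S)$ with $C,S \subseteq V(G)$, $N_G(C) \subseteq S$, $\mathrm{tw}(G[C]) \le \eta$ and $|S| \le 2\eta+2$. It is simple if $G[C]$ is connected and $N_G(C) = S$. Write $(C_1,S_1) \vartriangleleft (C_2,S_2)$ if $C_1 \subseteq C_2$. A simple $\eta$-separation $(C_1,S_1)$ is $\vartriangleleft$-maximal if there is no other simple $\eta$-separation $(C_2,S_2)$ with $(C_1,S_1) \vartriangleleft (C_2,S_2)$. For $v \in V(G)$, $R_G(v)$ is the vertex set of the connected component of $G$ containing $v$. For $X \subseteq V(G)$ and $v \notin X$, a set $S \subseteq V(G) \setminus (X \cup \{v\})$ is a $(v,X)$-separator if $R_{G-S}(v) \cap X = \emptyset$; it is an important $(v,X)$-separator if it is inclusion-minimal among $(v,X)$-separators and there is no $(v,X)$-separator $S'$ with $|S'| \le |S|$ and $R_{G-S}(v) \subsetneq R_{G-S'}(v)$. -}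

module Defs where

open import Data.Nat using (ℕ; suc; _≤_; _+_; _*_)
open import Data.Fin using (Fin)
open import Data.Fin.Subset using (Subset; _∈_; _∉_; _⊆_; ∣_∣)
open import Data.Bool using (Bool; true; false)
open import Data.Unit using (⊤)
open import Data.Product using (Σ; ∃; _×_; _,_)
open import Data.List using (List; []; _∷_; length; _++_; [_])
open import Data.List.Relation.Unary.Unique.Propositional using (Unique)
open import Data.List.Relation.Unary.Linked using (Linked)
open import Relation.Binary.PropositionalEquality using (_≡_; _≢_)
open import Relation.Nullary using (¬_)

record Graph (n : ℕ) : Set where
  field
    adj    : Fin n → Fin n → Bool
    sym    : ∀ u v → adj u v ≡ adj v u
    irrefl : ∀ v → adj v v ≡ false

Adj : ∀ {n} → Graph n → Fin n → Fin n → Set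
Adj G u v = Graph.adj G u v ≡ true

data Reach {n : ℕ} (R : Fin n → Fin n → Set) (P : Fin n → Set) (x : Fin n) : Fin n → Set where
  here : P x → Reach R P x x
  step : ∀ {y z} → Reach R P x y → R y z → P z → Reach R P x z

IsCycle : ∀ {m} → Graph m → Fin m → List (Fin m) → Set
IsCycle T x ys = (3 ≤ length (x ∷ ys)) × Unique (x ∷ ys) × Linked (Adj T) ((x ∷ ys) ++ [ x ])

record TreeDecomp {n : ℕ} (G : Graph n) (A : Subset n) (w : ℕ) : Set where
  field
    m         : ℕ
    T         : Graph (suc m)
    connected : ∀ s t → Reach (Adj T) (λ _ → ⊤) s t
    acyclic   : ∀ x ys → ¬ IsCycle T x ys
    bag       : Fin (suc m) → Subset n
    bag⊆A     : ∀ t → bag t ⊆ A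
    cover-v   : ∀ v → v ∈ A → ∃ λ t → v ∈ bag t
    cover-e   : ∀ u v → u ∈ A → v ∈ A → Adj G u v → ∃ λ t → (u ∈ bag t) × (v ∈ bag t)
    coherent  : ∀ v s t → v ∈ bag s → v ∈ bag t → Reach (Adj T) (λ r → v ∈ bag r) s t
    width     : ∀ t → ∣ bag t ∣ ≤ suc w

TwAtMost : ∀ {n} → Graph n → Subset n → ℕ → Set
TwAtMost G A w = TreeDecomp G A w

InN : ∀ {n} → Graph n → Subset n → Fin n → Set
InN G C u = (u ∉ C) × (∃ λ w → (w ∈ C) × Adj G w u)

ConnectedIn : ∀ {n} → Graph n → Subset n → Set
ConnectedIn G C = (∃ λ v → v ∈ C) × (∀ u v → u ∈ C → v ∈ C → Reach (Adj G) (λ x → x ∈ C) u v)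

Separation : ∀ {n} → Graph n → ℕ → Subset n → Subset n → Set
Separation G η C S =
  (∀ u → InN G C u → u ∈ S) × TwAtMost G C η × (∣ S ∣ ≤ 2 * η + 2)

SimpleSeparation : ∀ {n} → Graph n → ℕ → Subset n → Subset n → Set
SimpleSeparation G η C S =
  Separation G η C S × ConnectedIn G C × (∀ u → u ∈ S → InN G C u)

MaximalSimpleSeparation : ∀ {n} → Graph n → ℕ → Subset n → Subset n → Set
MaximalSimpleSeparation G η C S =
  SimpleSeparation G η C S ×
  ¬ (Σ (Subset _) λ C₂ → Σ (Subset _) λ S₂ →
       SimpleSeparation G η C₂ S₂ × (C ⊆ C₂) × ((C₂ , S₂) ≢ (C , S)))

Comp : ∀ {n} → Graph n → Subset n → Fin n → Fin n → Set
Comp G S v u = Reach (Adj G) (λ x → x ∉ S) v u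

IsSeparator : ∀ {n} → Graph n → Fin n → Subset n → Subset n → Set
IsSeparator G v X S =
  (∀ u → u ∈ S → (u ∉ X) × (u ≢ v)) × (∀ u → Comp G S v u → u ∉ X)

IsImportantSeparator : ∀ {n} → Graph n → Fin n → Subset n → Subset n → Set
IsImportantSeparator G v X S =
  IsSeparator G v X S ×
  (¬ (Σ (Subset _) λ S' → IsSeparator G v X S' × (S' ⊆ S) × (S' ≢ S))) ×
  (¬ (Σ (Subset _) λ S' → IsSeparator G v X S' × (∣ S' ∣ ≤ ∣ S ∣) ×
        (∀ u → Comp G S v u → Comp G S' v u) ×
        (∃ λ u → Comp G S' v u × ¬ Comp G S v u)))

{-# OPTIONS --safe #-}
-- Let S' be any (v, X)-separator with |S'| ≤ |S| whose component R of v in G − S' contains C.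
-- R avoids X, so tw(G[R]) ≤ tw(G − X) ≤ η, and N(R) ⊆ S'; hence (R, N(R)) is a simple
-- η-separation extending (C, S), and maximality forces R = C. A proper subset S' ⊂ S would
-- leave some vertex of S = N(C) in R, and a separator with a strictly larger component would
-- put a vertex outside C into R; both contradict R = C.
module Submission where

open import Defs
open import Level using (0ℓ)
open import Data.Nat using (ℕ; _≤_; _+_; _*_)
open import Data.Nat.Properties using (≤-trans)
open import Data.Bool using (true)
open import Data.Bool.Properties using (T-≡) renaming (_≟_ to _≟ᵇ_)
open import Data.Fin using (Fin)
open import Data.Fin.Properties using (any?; sequence)
open import Data.Fin.Subset using (Subset; _∈_; _∉_; ∁; _∩_; _⊆_; ∣_∣)
open import Data.Fin.Subset.Properties
  using (_∈?_; p⊆q⇒∣p∣≤∣q∣; x∈p∩q⁺; x∈p∩q⁻; x∉p⇒x∈∁p; ⊆-antisym)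
open import Data.Product using (_×_; _,_; proj₁; proj₂; ∃; Σ)
open import Data.Vec using (tabulate)
open import Data.Vec.Properties using (lookup∘tabulate; []=⇒lookup; lookup⇒[]=)
open import Effect.Monad using (RawMonad)
open import Function using (_∘_)
open import Function.Bundles using (Equivalence)
open import Relation.Binary.PropositionalEquality using (_≢_; refl; sym; trans; cong; subst)
open import Relation.Nullary using (¬_; yes; no; isYes; ¬?; _×-dec_; contradiction)
open import Relation.Nullary.Decidable using (toWitness; fromWitness; decidable-stable)
open import Relation.Nullary.Decidable.Core using (¬¬-excluded-middle)
open import Relation.Nullary.Negation using (¬¬-Monad)
open import Relation.Unary using (Pred; Decidable)

module _ {n : ℕ} {R : Fin n → Fin n → Set} where

  Reach-map : ∀ {P Q : Fin n → Set} {x y} → (∀ z → P z → Q z) → Reach R P x y → Reach R Q x y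
  Reach-map f (here p)     = here (f _ p)
  Reach-map f (step r e p) = step (Reach-map f r) e (f _ p)

  Reach-prefixes : ∀ {P : Fin n → Set} {x y} → Reach R P x y → Reach R (Reach R P x) x y
  Reach-prefixes (here p)     = here (here p)
  Reach-prefixes (step r e p) = step (Reach-prefixes r) e (step r e p)

  Reach-cons : ∀ {P : Fin n → Set} {x y z} → R x y → P x → Reach R P y z → Reach R P x z
  Reach-cons e px (here py)     = step (here px) e py
  Reach-cons e px (step r e′ p) = step (Reach-cons e px r) e′ p

  Reach-reverse : ∀ {P : Fin n → Set} {x y} → (∀ {a b} → R a b → R b a) →
                  Reach R P x y → Reach R P y x
  Reach-reverse sym-R (here p)     = here p
  Reach-reverse sym-R (step r e p) = Reach-cons (sym-R e) p (Reach-reverse sym-R r)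

  Reach-trans : ∀ {P : Fin n → Set} {x y z} → Reach R P x y → Reach R P y z → Reach R P x z
  Reach-trans r (here _)      = r
  Reach-trans r (step r′ e p) = step (Reach-trans r r′) e p

¬¬-decidable : ∀ {n} (P : Pred (Fin n) 0ℓ) → ¬ ¬ Decidable P
¬¬-decidable P = sequence (RawMonad.rawApplicative ¬¬-Monad) (λ _ → ¬¬-excluded-middle)

module _ {n : ℕ} {P : Pred (Fin n) 0ℓ} where

  subsetOf : Decidable P → Subset n
  subsetOf P? = tabulate (isYes ∘ P?)

  ∈-subsetOf⁺ : (P? : Decidable P) {u : Fin n} → P u → u ∈ subsetOf P?
  ∈-subsetOf⁺ P? {u} pu =
    lookup⇒[]= u _ (trans (lookup∘tabulate _ u) (Equivalence.to T-≡ (fromWitness {a? = P? u} pu)))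

  ∈-subsetOf⁻ : (P? : Decidable P) {u : Fin n} → u ∈ subsetOf P? → P u
  ∈-subsetOf⁻ P? {u} u∈ =
    toWitness {a? = P? u} (Equivalence.from T-≡ (trans (sym (lookup∘tabulate _ u)) ([]=⇒lookup u∈)))

TwAtMost-mono : ∀ {n} {G : Graph n} {A B : Subset n} {w} → B ⊆ A → TwAtMost G A w → TwAtMost G B w
TwAtMost-mono {B = B} B⊆A td = record
  { m         = m
  ; T         = T
  ; connected = connected
  ; acyclic   = acyclic
  ; bag       = λ t → bag t ∩ B
  ; bag⊆A     = λ t → proj₂ ∘ x∈p∩q⁻ _ _
  ; cover-v   = λ v v∈B → let (t , v∈t) = cover-v v (B⊆A v∈B) in t , x∈p∩q⁺ (v∈t , v∈B)
  ; cover-e   = λ u v u∈B v∈B e →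
      let (t , u∈t , v∈t) = cover-e u v (B⊆A u∈B) (B⊆A v∈B) e
      in  t , x∈p∩q⁺ (u∈t , u∈B) , x∈p∩q⁺ (v∈t , v∈B)
  ; coherent  = λ v s t v∈s v∈t →
      let (v∈bag-s , v∈B) = x∈p∩q⁻ _ _ v∈s
      in  Reach-map (λ _ v∈r → x∈p∩q⁺ (v∈r , v∈B))
                    (coherent v s t v∈bag-s (proj₁ (x∈p∩q⁻ _ _ v∈t)))
  ; width     = λ t → ≤-trans (p⊆q⇒∣p∣≤∣q∣ (proj₁ ∘ x∈p∩q⁻ (bag t) B)) (width t)
  }
  where open TreeDecomp td

module _ {n : ℕ} (G : Graph n) where

  Adj-sym : ∀ {a b} → Adj G a b → Adj G b a
  Adj-sym {a} {b} e = trans (sym (Graph.sym G a b)) e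

  InN? : (C : Subset n) → Decidable (InN G C)
  InN? C u = ¬? (u ∈? C) ×-dec any? (λ w → (w ∈? C) ×-dec (Graph.adj G w u ≟ᵇ true))

  neighbourhood : Subset n → Subset n
  neighbourhood C = subsetOf (InN? C)

  Comp-connected : ∀ {S v a b} → Comp G S v a → Comp G S v b → Reach (Adj G) (Comp G S v) a b
  Comp-connected ra rb = Reach-trans (Reach-reverse Adj-sym (Reach-prefixes ra)) (Reach-prefixes rb)

  ∈-connected⇒Comp : ∀ {C S v u} → ConnectedIn G C → (∀ x → x ∈ C → x ∉ S) →
                     v ∈ C → u ∈ C → Comp G S v u
  ∈-connected⇒Comp {v = v} {u} (_ , connC) C∩S=∅ v∈C u∈C = Reach-map C∩S=∅ (connC v u v∈C u∈C)

  module _ {S : Subset n} {v : Fin n} (Comp? : Decidable (Comp G S v)) where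

    neighbourhood-component⊆ : neighbourhood (subsetOf Comp?) ⊆ S
    neighbourhood-component⊆ {x} x∈NR with x ∈? S
    ... | yes x∈S = x∈S
    ... | no x∉S  =
      let (x∉R , w , w∈R , w~x) = ∈-subsetOf⁻ (InN? (subsetOf Comp?)) x∈NR
      in  contradiction (∈-subsetOf⁺ Comp? (step (∈-subsetOf⁻ Comp? w∈R) w~x x∉S)) x∉R

    component-connected : v ∉ S → ConnectedIn G (subsetOf Comp?)
    component-connected v∉S =
        (v , ∈-subsetOf⁺ Comp? (here v∉S))
      , λ a b a∈R b∈R → Reach-map (λ _ → ∈-subsetOf⁺ Comp?)
                          (Comp-connected (∈-subsetOf⁻ Comp? a∈R) (∈-subsetOf⁻ Comp? b∈R))

  component-simpleSeparation : ∀ {η X S v} → IsSeparator G v X S → TwAtMost G (∁ X) η →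
    ∣ S ∣ ≤ 2 * η + 2 → (Comp? : Decidable (Comp G S v)) →
    SimpleSeparation G η (subsetOf Comp?) (neighbourhood (subsetOf Comp?))
  component-simpleSeparation (S-admissible , Comp∩X=∅) tw ∣S∣≤ Comp? =
      ( (λ _ → ∈-subsetOf⁺ (InN? _))
      , TwAtMost-mono (λ {x} x∈R → x∉p⇒x∈∁p (Comp∩X=∅ x (∈-subsetOf⁻ Comp? x∈R))) tw
      , ≤-trans (p⊆q⇒∣p∣≤∣q∣ (neighbourhood-component⊆ Comp?)) ∣S∣≤ )
    , component-connected Comp? (λ v∈S → proj₂ (S-admissible _ v∈S) refl)
    , (λ _ → ∈-subsetOf⁻ (InN? _))

module SimpleSeparationAt {n η} {G : Graph n} {C S : Subset n}
  (sepC : Separation G η C S) (connC : ConnectedIn G C) (S⊆N : ∀ u → u ∈ S → InN G C u)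
  {v : Fin n} (v∈C : v ∈ C) where

  C∩S=∅ : ∀ x → x ∈ C → x ∉ S
  C∩S=∅ x x∈C x∈S = proj₁ (S⊆N x x∈S) x∈C

  Comp⇒∈C : ∀ {u} → Comp G S v u → u ∈ C
  Comp⇒∈C (here _) = v∈C
  Comp⇒∈C (step {y} {z} r y~z z∉S) with z ∈? C
  ... | yes z∈C = z∈C
  ... | no z∉C  = contradiction (proj₁ sepC z (z∉C , y , Comp⇒∈C r , y~z)) z∉S

  ∈C⇒Comp : ∀ {S′ u} → (∀ x → x ∈ C → x ∉ S′) → u ∈ C → Comp G S′ v u
  ∈C⇒Comp C∩S′=∅ = ∈-connected⇒Comp G connC C∩S′=∅ v∈C

  separates : ∀ {X} → (∀ u → u ∈ X → (u ∉ C) × (u ∉ S)) → IsSeparator G v X S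
  separates X∩[C∪S]=∅ =
      (λ u u∈S → (λ u∈X → proj₂ (X∩[C∪S]=∅ u u∈X) u∈S) , λ { refl → C∩S=∅ u v∈C u∈S })
    , λ u r u∈X → proj₁ (X∩[C∪S]=∅ u u∈X) (Comp⇒∈C r)

  module Maximal {X : Subset n} (tw : TwAtMost G (∁ X) η)
    (maximal : ¬ (Σ (Subset n) λ C₂ → Σ (Subset n) λ S₂ →
                   SimpleSeparation G η C₂ S₂ × (C ⊆ C₂) × ((C₂ , S₂) ≢ (C , S)))) where

    separator-component⊆C : ∀ {S′ u} → IsSeparator G v X S′ → ∣ S′ ∣ ≤ ∣ S ∣ →
      (∀ x → x ∈ C → Comp G S′ v x) → Comp G S′ v u → u ∈ C
    separator-component⊆C {S′} {u} sep′ ∣S′∣≤∣S∣ C⊆Comp r =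
      -- Reachability in G − S′ is only ¬¬-decidable here, which suffices as u ∈ C is decidable.
      decidable-stable (u ∈? C) λ u∉C → ¬¬-decidable (Comp G S′ v) λ Comp? →
        maximal ( subsetOf Comp?
                , neighbourhood G (subsetOf Comp?)
                , component-simpleSeparation G sep′ tw (≤-trans ∣S′∣≤∣S∣ (proj₂ (proj₂ sepC))) Comp?
                , (λ {x} x∈C → ∈-subsetOf⁺ Comp? (C⊆Comp x x∈C))
                , λ R,NR≡C,S → u∉C (subst (u ∈_) (cong proj₁ R,NR≡C,S) (∈-subsetOf⁺ Comp? r)) )

    minimal : ¬ (Σ (Subset n) λ S′ → IsSeparator G v X S′ × (S′ ⊆ S) × (S′ ≢ S))
    minimal (S′ , sep′ , S′⊆S , S′≢S) = S′≢S (⊆-antisym S′⊆S S⊆S′)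
      where
      C∩S′=∅ : ∀ x → x ∈ C → x ∉ S′
      C∩S′=∅ x x∈C = C∩S=∅ x x∈C ∘ S′⊆S

      S⊆S′ : S ⊆ S′
      S⊆S′ {s} s∈S = decidable-stable (s ∈? S′) λ s∉S′ →
        let (s∉C , w , w∈C , w~s) = S⊆N s s∈S
        in  s∉C (separator-component⊆C sep′ (p⊆q⇒∣p∣≤∣q∣ S′⊆S) (λ _ → ∈C⇒Comp C∩S′=∅)
                   (step (∈C⇒Comp C∩S′=∅ w∈C) w~s s∉S′))

    important : ¬ (Σ (Subset n) λ S′ → IsSeparator G v X S′ × (∣ S′ ∣ ≤ ∣ S ∣) ×
                    (∀ u → Comp G S v u → Comp G S′ v u) × (∃ λ u → Comp G S′ v u × ¬ Comp G S v u))
    important (S′ , sep′ , ∣S′∣≤∣S∣ , Comp⊆Comp′ , u , r′ , ¬r) =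
      ¬r (∈C⇒Comp C∩S=∅
            (separator-component⊆C sep′ ∣S′∣≤∣S∣ (λ x → Comp⊆Comp′ x ∘ ∈C⇒Comp C∩S=∅) r′))

lemma20 : ∀ {n} (G : Graph n) (η : ℕ) (X : Subset n) → 1 ≤ η → TwAtMost G (∁ X) η →
    (C S : Subset n) → MaximalSimpleSeparation G η C S → (v : Fin n) → v ∈ C →
    (∀ u → u ∈ X → (u ∉ C) × (u ∉ S)) → IsImportantSeparator G v X S
lemma20 G η X _ tw C S ((sepC , connC , S⊆N) , maximal) v v∈C X∩[C∪S]=∅ =
  separates X∩[C∪S]=∅ , minimal , important
  where
  open SimpleSeparationAt sepC connC S⊆N v∈C
  open Maximal tw maximal
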